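{- Let $k\geqslant 2$ be an integer and let $K(z)=\sum_{n\geqslant 0}\kappa(n)z^n$, where $\kappa$ is the sequence defined in the context. Then, as an identity of formal power series (equivalently of analytic functions on $|z|<1$), $$K(z)-\left(\sum_{a=0}^{k-1}(a+1)z^a\right)K(z^k)-\left(\sum_{a=0}^{k^2-1}z^a\right)K(z^{k^2})=-\sum_{n=0}^{k-1}z^n.$$
   Context: Fix an integer $k\geqslant 2$. For $i\in\{0,1,\ldots,k-1\}$ let $\mathbf{A}_i=\begin{pmatrix} i+1&1\\ 1&0\end{pmatrix}$. For an integer $n\geqslant 0$ with standard base-$k$ expansion $(n)_k=i_s\cdots i_1i_0$ (no leading zeros; the empty word for $n=0$), define $\kappa(n)=[1\ 0]\,\mathbf{A}_{i_0}\mathbf{A}_{i_1}\cdots\mathbf{A}_{i_s}\,[1\ 0]^T$, the empty product being the identity matrix (so $\kappa(0)=1$). -}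

module Defs where

open import Data.Nat using (ℕ; zero; suc; _+_; _*_; _∸_; _<?_)
open import Data.Nat.DivMod using (_/_; _%_)
open import Data.Integer as ℤ using (ℤ; +_)
open import Data.List using (List; []; _∷_; foldr; map; upTo)
open import Relation.Nullary.Decidable using (does)
open import Data.Bool using (if_then_else_)
open import Data.Nat using (_≟_)

-- Base-k digits, least significant first: (n)_k = i_s ⋯ i_1 i_0 gives
-- the list i_0 ∷ i_1 ∷ ⋯ ∷ i_s ∷ [] (empty for n = 0).
-- Only meaningful for k ≥ 2 (junk value [] for k < 2).
-- The fuel argument is ≥ the number of digits when fuel = n.

digitsFuel : ℕ → ℕ → ℕ → List ℕ
digitsFuel (suc (suc j)) (suc fuel) zero = []
digitsFuel (suc (suc j)) (suc fuel) n@(suc _) =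
  (n % suc (suc j)) ∷ digitsFuel (suc (suc j)) fuel (n / suc (suc j))
digitsFuel _ _ _ = []

digits : ℕ → ℕ → List ℕ
digits k n = digitsFuel k n n

record Mat2 : Set where
  constructor mat
  field
    a11 a12 a21 a22 : ℕ
open Mat2 public

_·_ : Mat2 → Mat2 → Mat2
mat a b c d · mat e f g h = mat (a * e + b * g) (a * f + b * h) (c * e + d * g) (c * f + d * h)

I₂ : Mat2
I₂ = mat 1 0 0 1

A : ℕ → Mat2
A i = mat (suc i) 1 1 0

prodA : List ℕ → Mat2
prodA = foldr (λ i M → A i · M) I₂

-- κ(n) = [1 0] A_{i_0} ⋯ A_{i_s} [1 0]^T  (the top-left entry)
κ : ℕ → ℕ → ℕ
κ k n = a11 (prodA (digits k n))

Series : Set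
Series = ℕ → ℤ

sumℤ : List ℤ → ℤ
sumℤ = foldr ℤ._+_ (+ 0)

infixl 6 _⊕_ _⊖_
infixl 7 _⊛_
infix 8 _∘pow_
infix 9 ⊝_

_⊕_ : Series → Series → Series
(f ⊕ g) n = f n ℤ.+ g n

_⊖_ : Series → Series → Series
(f ⊖ g) n = f n ℤ.- g n

⊝_ : Series → Series
(⊝ f) n = ℤ.- f n

_⊛_ : Series → Series → Series
(f ⊛ g) n = sumℤ (map (λ i → f i ℤ.* g (n ∸ i)) (upTo (suc n)))

-- substitution z ↦ z^m :  f(z^m) has coefficient f(j) at n = j*m, 0 elsewhere
_∘pow_ : Series → ℕ → Series
(f ∘pow m) n = sumℤ (map (λ j → if does (j * m ≟ n) then f j else + 0) (upTo (suc n)))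

poly : ℕ → (ℕ → ℤ) → Series
poly m c n = if does (n <? m) then c n else + 0

K : ℕ → Series
K k n = + κ k n

-- Reading off the coefficient of z^n, the Cauchy product of a polynomial of
-- degree < m with F(z^m) has the single term c(n mod m) F(⌊n/m⌋). The
-- identity therefore says κ(n) = (n mod k + 1) κ(⌊n/k⌋) + κ(⌊n/k²⌋) for
-- n ≥ k, and κ(n) = n + 1 for n < k. Both come from peeling off the least
-- significant digit: A_i M has top-left entry (i+1)·M₁₁ + M₂₁ and bottom-left
-- entry M₁₁, and for the product over the digits of q > 0 the bottom-left
-- entry is κ(⌊q/k⌋).
module Submission where

open import Defs
open import Data.Nat using (ℕ; suc; _≤_; _*_)
open import Data.Integer using (+_)
open import Relation.Binary.PropositionalEquality using (_≡_)

open import Data.Nat using (zero; _+_; _∸_; _<_; _≮_; _<?_; _≟_; s≤s; s≤s⁻¹; z≤n; NonZero)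
open import Data.Nat.Properties
open import Data.Nat.DivMod
open import Data.Nat.Divisibility using (divides; m%n≡0⇒n∣m)
open import Data.Integer as ℤ using (ℤ)
import Data.Integer.Properties as ℤ
open import Data.Integer.Tactic.RingSolver using (solve-∀)
open import Data.List using ([]; _∷_; map; upTo; applyUpTo)
open import Data.List.Properties using (map-upTo)
open import Data.Bool using (if_then_else_)
open import Function using (_∘_)
open import Relation.Binary.PropositionalEquality using (_≢_; refl; sym; trans; cong; cong₂; module ≡-Reasoning)
open import Relation.Nullary using (Dec; yes; no; ¬_)
open import Relation.Nullary.Decidable using (does; dec-true; dec-false)

if-does-yes : ∀ {a p} {A : Set a} {P : Set p} (d : Dec P) {x y : A} → P → (if does d then x else y) ≡ x
if-does-yes d p rewrite dec-true d p = refl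

if-does-no : ∀ {a p} {A : Set a} {P : Set p} (d : Dec P) {x y : A} → ¬ P → (if does d then x else y) ≡ y
if-does-no d ¬p rewrite dec-false d ¬p = refl

sumℤ-applyUpTo-zero : ∀ N (f : ℕ → ℤ) → (∀ {i} → i < N → f i ≡ + 0) → sumℤ (applyUpTo f N) ≡ + 0
sumℤ-applyUpTo-zero zero    f vanish = refl
sumℤ-applyUpTo-zero (suc N) f vanish
  rewrite vanish (s≤s z≤n) | sumℤ-applyUpTo-zero N (f ∘ suc) (vanish ∘ s≤s) = refl

sumℤ-applyUpTo-single : ∀ N (f : ℕ → ℤ) {t} → t < N → (∀ {i} → i < N → i ≢ t → f i ≡ + 0) →
  sumℤ (applyUpTo f N) ≡ f t
sumℤ-applyUpTo-single (suc N) f {zero} _ vanish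
  rewrite sumℤ-applyUpTo-zero N (f ∘ suc) (λ i<N → vanish (s≤s i<N) λ ()) = ℤ.+-identityʳ (f 0)
sumℤ-applyUpTo-single (suc N) f {suc t} (s≤s t<N) vanish
  rewrite vanish (s≤s z≤n) λ () =
    trans (ℤ.+-identityˡ _) (sumℤ-applyUpTo-single N (f ∘ suc) t<N λ i<N i≢t → vanish (s≤s i<N) (i≢t ∘ suc-injective))

[n∸i]%m≡0⇒n%m≡i : ∀ {m i n} .{{_ : NonZero m}} → i < m → i ≤ n → (n ∸ i) % m ≡ 0 → n % m ≡ i
[n∸i]%m≡0⇒n%m≡i {m} {i} {n} i<m i≤n n∸i%m≡0 with m%n≡0⇒n∣m (n ∸ i) m n∸i%m≡0
... | divides q n∸i≡q*m = begin
  n % m             ≡⟨ cong (_% m) (m+[n∸m]≡n i≤n) ⟨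
  (i + (n ∸ i)) % m ≡⟨ cong (λ x → (i + x) % m) n∸i≡q*m ⟩
  (i + q * m) % m   ≡⟨ [m+kn]%n≡m%n i q m ⟩
  i % m             ≡⟨ m<n⇒m%n≡m i<m ⟩
  i                 ∎
  where open ≡-Reasoning

∘pow-multiple : ∀ (f : Series) m .{{_ : NonZero m}} q → (f ∘pow m) (q * m) ≡ f q
∘pow-multiple f m q = begin
  (f ∘pow m) (q * m)                  ≡⟨ cong sumℤ (map-upTo term (suc (q * m))) ⟩
  sumℤ (applyUpTo term (suc (q * m))) ≡⟨ sumℤ-applyUpTo-single _ term (s≤s (m≤m*n q m)) vanish ⟩
  term q                              ≡⟨ if-does-yes (q * m ≟ q * m) refl ⟩
  f q                                 ∎
  where
  open ≡-Reasoning
  term : ℕ → ℤ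
  term j = if does (j * m ≟ q * m) then f j else + 0
  vanish : ∀ {i} → i < suc (q * m) → i ≢ q → term i ≡ + 0
  vanish {i} _ i≢q = if-does-no (i * m ≟ q * m) (i≢q ∘ *-cancelʳ-≡ i q m)

∘pow-nonmultiple : ∀ (f : Series) m .{{_ : NonZero m}} n → n % m ≢ 0 → (f ∘pow m) n ≡ + 0
∘pow-nonmultiple f m n n%m≢0 =
  trans (cong sumℤ (map-upTo term (suc n))) (sumℤ-applyUpTo-zero (suc n) term vanish)
  where
  term : ℕ → ℤ
  term j = if does (j * m ≟ n) then f j else + 0
  vanish : ∀ {i} → i < suc n → term i ≡ + 0
  vanish {i} _ = if-does-no (i * m ≟ n) λ i*m≡n → n%m≢0 (trans (cong (_% m) (sym i*m≡n)) (m*n%n≡0 i m))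

poly-< : ∀ m c {n} → n < m → poly m c n ≡ c n
poly-< m c {n} = if-does-yes (n <? m)

poly-≮ : ∀ m c {n} → n ≮ m → poly m c n ≡ + 0
poly-≮ m c {n} = if-does-no (n <? m)

poly-⊛-∘pow : ∀ m .{{_ : NonZero m}} (c : ℕ → ℤ) (f : Series) n →
  (poly m c ⊛ (f ∘pow m)) n ≡ c (n % m) ℤ.* f (n / m)
poly-⊛-∘pow m c f n = begin
  (poly m c ⊛ (f ∘pow m)) n                ≡⟨ cong sumℤ (map-upTo term (suc n)) ⟩
  sumℤ (applyUpTo term (suc n))            ≡⟨ sumℤ-applyUpTo-single _ term (s≤s (m%n≤m n m)) vanish ⟩
  term (n % m)                             ≡⟨ cong₂ ℤ._*_ (poly-< m c (m%n<n n m)) (cong (f ∘pow m) n∸n%m≡n/m*m) ⟩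
  c (n % m) ℤ.* (f ∘pow m) (n / m * m)     ≡⟨ cong (c (n % m) ℤ.*_) (∘pow-multiple f m (n / m)) ⟩
  c (n % m) ℤ.* f (n / m)                  ∎
  where
  open ≡-Reasoning
  term : ℕ → ℤ
  term i = poly m c i ℤ.* (f ∘pow m) (n ∸ i)
  n∸n%m≡n/m*m : n ∸ n % m ≡ n / m * m
  n∸n%m≡n/m*m = trans (cong (_∸ n % m) (m≡m%n+[m/n]*n n m)) (m+n∸m≡n (n % m) (n / m * m))
  vanish : ∀ {i} → i < suc n → i ≢ n % m → term i ≡ + 0
  vanish {i} (s≤s i≤n) i≢n%m with i <? m
  ... | no  i≮m = trans (cong (ℤ._* (f ∘pow m) (n ∸ i)) (poly-≮ m c i≮m)) (ℤ.*-zeroˡ ((f ∘pow m) (n ∸ i)))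
  ... | yes i<m = trans (cong (c' ℤ.*_) (∘pow-nonmultiple f m (n ∸ i) (i≢n%m ∘ sym ∘ [n∸i]%m≡0⇒n%m≡i i<m i≤n)))
                        (ℤ.*-zeroʳ c')
    where c' = poly m c i

A·-a11 : ∀ i M → a11 (A i · M) ≡ suc i * a11 M + a21 M
A·-a11 i M = cong (_+_ (suc i * a11 M)) (*-identityˡ (a21 M))

A·-a21 : ∀ i M → a21 (A i · M) ≡ a11 M
A·-a21 i M = trans (+-identityʳ (1 * a11 M)) (*-identityˡ (a11 M))

module Radix (j : ℕ) where

  k : ℕ
  k = suc (suc j)

  suc-/-≤ : ∀ n → suc n / k ≤ n
  suc-/-≤ n = s≤s⁻¹ (m/n<m (suc n) k (s≤s (s≤s z≤n)))

  digitsFuel-zero : ∀ fuel → digitsFuel k fuel 0 ≡ []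
  digitsFuel-zero zero       = refl
  digitsFuel-zero (suc fuel) = refl

  digitsFuel-irrelevant : ∀ {f₁ f₂} n → n ≤ f₁ → n ≤ f₂ → digitsFuel k f₁ n ≡ digitsFuel k f₂ n
  digitsFuel-irrelevant {f₁} {f₂} zero _ _ = trans (digitsFuel-zero f₁) (sym (digitsFuel-zero f₂))
  digitsFuel-irrelevant {suc f₁} {suc f₂} (suc n) (s≤s n≤f₁) (s≤s n≤f₂) =
    cong (suc n % k ∷_) (digitsFuel-irrelevant (suc n / k) (≤-trans (suc-/-≤ n) n≤f₁) (≤-trans (suc-/-≤ n) n≤f₂))

  digits-suc : ∀ n → digits k (suc n) ≡ suc n % k ∷ digits k (suc n / k)
  digits-suc n = cong (suc n % k ∷_) (digitsFuel-irrelevant (suc n / k) (suc-/-≤ n) ≤-refl)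

  ν : ℕ → ℕ
  ν n = a21 (prodA (digits k n))

  κ-suc : ∀ n → κ k (suc n) ≡ suc (suc n % k) * κ k (suc n / k) + ν (suc n / k)
  κ-suc n = trans (cong (a11 ∘ prodA) (digits-suc n)) (A·-a11 (suc n % k) (prodA (digits k (suc n / k))))

  0<q⇒ν≡κ[q/k] : ∀ {q} → 0 < q → ν q ≡ κ k (q / k)
  0<q⇒ν≡κ[q/k] {suc q} _ = trans (cong (a21 ∘ prodA) (digits-suc q)) (A·-a21 (suc q % k) (prodA (digits k (suc q / k))))

  n<k⇒κ≡1+n : ∀ {n} → n < k → κ k n ≡ suc n
  n<k⇒κ≡1+n {zero}  _   = refl
  n<k⇒κ≡1+n {suc n} n<k = begin
    κ k (suc n)                                       ≡⟨ κ-suc n ⟩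
    suc (suc n % k) * κ k (suc n / k) + ν (suc n / k) ≡⟨ cong₂ (λ r q → suc r * κ k q + ν q) (m<n⇒m%n≡m n<k) (m<n⇒m/n≡0 n<k) ⟩
    suc (suc n) * 1 + 0                               ≡⟨ trans (+-identityʳ _) (*-identityʳ _) ⟩
    suc (suc n)                                       ∎
    where open ≡-Reasoning

  κ-recurrence : ∀ {n} → k ≤ n → κ k n ≡ suc (n % k) * κ k (n / k) + κ k (n / (k * k))
  κ-recurrence {suc n} k≤n = begin
    κ k (suc n)                                             ≡⟨ κ-suc n ⟩
    suc (suc n % k) * κ k (suc n / k) + ν (suc n / k)       ≡⟨ cong (_+_ (suc (suc n % k) * κ k (suc n / k))) ν[n/k]≡κ[n/k²] ⟩
    suc (suc n % k) * κ k (suc n / k) + κ k (suc n / (k * k)) ∎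
    where
    open ≡-Reasoning
    ν[n/k]≡κ[n/k²] : ν (suc n / k) ≡ κ k (suc n / (k * k))
    ν[n/k]≡κ[n/k²] = trans (0<q⇒ν≡κ[q/k] (m≥n⇒m/n>0 k≤n)) (cong (κ k) (m/n/o≡m/[n*o] (suc n) k k))

  κ-defect : ∀ n → + κ k n ℤ.- + suc (n % k) ℤ.* + κ k (n / k) ℤ.- + 1 ℤ.* + κ k (n / (k * k))
                   ≡ ℤ.- poly k (λ _ → + 1) n
  κ-defect n with n <? k
  ... | yes n<k
    rewrite poly-< k (λ _ → + 1) n<k | m<n⇒m%n≡m n<k | m<n⇒m/n≡0 n<k
          | m<n⇒m/n≡0 (≤-trans n<k (m≤m*n k k)) | n<k⇒κ≡1+n n<k = base (+ suc n)
    where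
    base : ∀ x → x ℤ.- x ℤ.* + 1 ℤ.- + 1 ℤ.* + 1 ≡ ℤ.- + 1
    base = solve-∀
  ... | no n≮k rewrite poly-≮ k (λ _ → + 1) n≮k | κ-recurrence (≮⇒≥ n≮k) = begin
    + (a * C + B) ℤ.- + a ℤ.* + C ℤ.- + 1 ℤ.* + B
      ≡⟨ cong (λ x → x ℤ.- + a ℤ.* + C ℤ.- + 1 ℤ.* + B) (trans (ℤ.pos-+ (a * C) B) (cong (ℤ._+ + B) (ℤ.pos-* a C))) ⟩
    (+ a ℤ.* + C ℤ.+ + B) ℤ.- + a ℤ.* + C ℤ.- + 1 ℤ.* + B
      ≡⟨ cancel (+ a) (+ C) (+ B) ⟩
    + 0 ∎
    where
    open ≡-Reasoning
    a C B : ℕ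
    a = suc (n % k)
    C = κ k (n / k)
    B = κ k (n / (k * k))
    cancel : ∀ x y z → (x ℤ.* y ℤ.+ z) ℤ.- x ℤ.* y ℤ.- + 1 ℤ.* z ≡ + 0
    cancel = solve-∀

theorem1 : (k : ℕ) → 2 ≤ k → (n : ℕ) →
    (K k ⊖ poly k (λ a → + suc a) ⊛ (K k ∘pow k) ⊖ poly (k * k) (λ a → + 1) ⊛ (K k ∘pow (k * k))) n ≡ (⊝ poly k (λ a → + 1)) n
theorem1 k@(suc (suc j)) _ n = trans
  (cong₂ (λ x y → + κ k n ℤ.- x ℤ.- y)
         (poly-⊛-∘pow k (λ a → + suc a) (K k) n)
         (poly-⊛-∘pow (k * k) (λ a → + 1) (K k) n))
  (κ-defect n)
  where open Radix j using (κ-defect)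
theorem1 (suc zero) (s≤s ()) n
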